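{- Let $r,n$ be positive integers and $g=[\sigma;c_1,\ldots,c_n]\in G(r,n)$. Then for every $i\in[n]$, $$r\,h_i(g)+k_i(g)=r\,d_i(g)+[c_i]_r,$$ and in particular $\sum_i(r\,h_i(g)+k_i(g))=\mathrm{fmaj}(g)$.
   Context: $G(r,n)$ is the group of $n\times n$ monomial matrices with $r$-th roots of unity as nonzero entries; $g=[\sigma;c_1,\ldots,c_n]$ means row $i$ has entry $e^{2\pi ic_i/r}$ in column $\sigma(i)$. $[c]_s$ is the least nonnegative residue of $c$ modulo $s$. $\mathrm{HDes}(g)=\{i\in[n-1]:c_i\equiv c_{i+1}\ (\bmod r),\ \sigma(i)>\sigma(i+1)\}$, $h_i(g)=\#\{j\ge i:j\in\mathrm{HDes}(g)\}$; $k_n(g)=[c_n]_r$ and $k_i(g)=k_{i+1}(g)+[c_i-c_{i+1}]_r$ for $i<n$. $\mathrm{Des}(g)=\{i\in[n-1]:[c_i]_r<[c_{i+1}]_r,\text{ or }[c_i]_r=[c_{i+1}]_r\text{ and }\sigma(i)>\sigma(i+1)\}$, $d_i(g)=\#\{j\ge i:j\in\mathrm{Des}(g)\}$, and the flag-major index is $\mathrm{fmaj}(g)=r\sum_{i\in\mathrm{Des}(g)}i+\sum_i[c_i]_r$. -}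

module Defs where

open import Data.Nat using (ℕ; zero; suc; _+_; _*_; _∸_; _<_; _<?_; _≟_; NonZero)
open import Data.Nat.Properties using (<-trans; n<1+n)
open import Data.Integer as ℤ using (ℤ; _%ℕ_)
open import Data.Fin using (Fin; toℕ; fromℕ<)
open import Data.Fin.Permutation using (Permutation′; _⟨$⟩ʳ_)
open import Data.List using (List; map; allFin)
open import Data.Nat.ListAction using (sum)
open import Data.Bool using (Bool; true; false; _∧_; _∨_)
open import Relation.Nullary.Decidable using (does; yes; no)

-- An element g = [σ; c_1,…,c_n] of G(r,n) is given by a permutation σ of Fin n
-- and a colour vector c : Fin n → ℤ (only c_i mod r matters).
-- Positions are 0-based in Agda: Fin index j stands for the paper's position j+1.

module _ (r : ℕ) .{{_ : NonZero r}} {n : ℕ} (σ : Permutation′ n) (c : Fin n → ℤ) where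

  res : ℤ → ℕ
  res x = x %ℕ r

  cc : ℕ → ℤ
  cc j with j <? n
  ... | yes j<n = c (fromℕ< j<n)
  ... | no _ = ℤ.+ 0

  isHDes : ℕ → Bool
  isHDes j with suc j <? n
  ... | no _ = false
  ... | yes sj<n =
    let a = fromℕ< (<-trans (n<1+n j) sj<n)
        b = fromℕ< sj<n
    in does (res (c a) ≟ res (c b)) ∧ does (toℕ (σ ⟨$⟩ʳ b) <? toℕ (σ ⟨$⟩ʳ a))

  isDes : ℕ → Bool
  isDes j with suc j <? n
  ... | no _ = false
  ... | yes sj<n =
    let a = fromℕ< (<-trans (n<1+n j) sj<n)
        b = fromℕ< sj<n
    in does (res (c a) <? res (c b))
       ∨ (does (res (c a) ≟ res (c b)) ∧ does (toℕ (σ ⟨$⟩ʳ b) <? toℕ (σ ⟨$⟩ʳ a)))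

  b2n : Bool → ℕ
  b2n true = 1
  b2n false = 0

  countFrom : (ℕ → Bool) → ℕ → ℕ → ℕ
  countFrom P start zero = 0
  countFrom P start (suc len) = b2n (P start) + countFrom P (suc start) len

  h : Fin n → ℕ
  h i = countFrom isHDes (toℕ i) (n ∸ toℕ i)

  d : Fin n → ℕ
  d i = countFrom isDes (toℕ i) (n ∸ toℕ i)

  -- kd m = k_{n-m}(g) (paper indexing):  k_n = [c_n]_r,  k_j = k_{j+1} + [c_j - c_{j+1}]_r
  kd : ℕ → ℕ
  kd zero = res (cc (n ∸ 1))
  kd (suc m) = kd m + res (cc (n ∸ 2 ∸ m) ℤ.- cc (n ∸ 1 ∸ m))

  k : Fin n → ℕ
  k i = kd (n ∸ 1 ∸ toℕ i)

  sumDes : ℕ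
  sumDes = sum (map (λ j → b2n (isDes (toℕ j)) * suc (toℕ j)) (allFin n))

  fmaj : ℕ
  fmaj = r * sumDes + sum (map (λ i → res (c i)) (allFin n))

-- Passing from position i+1 to i, k grows by [c_i - c_{i+1}]_r, and [c_{i+1}]_r + [c_i - c_{i+1}]_r is
-- [c_i]_r plus a carry of r exactly when [c_i]_r < [c_{i+1}]_r. Those i are the descents that are not
-- h-descents, and every other i is a descent iff it is an h-descent. Hence the identity at i+1 gives the
-- identity at i, starting from i = n where h_n = d_n = 0 and k_n = [c_n]_r. Summing over i, a descent j is
-- counted by d_1, …, d_j, so Σ d_i = Σ_{j ∈ Des} j.

module Submission where

open import Defs
open import Data.Nat using (ℕ; zero; suc; _+_; _*_; _∸_; _<_; _≤_; _<?_; _≟_; NonZero; z<s)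
open import Data.Nat.Properties
open import Data.Integer as ℤ using (ℤ; +_; -[1+_]; _%ℕ_; _/ℕ_)
open import Data.Integer.Properties using (+-injective)
open import Data.Integer.DivMod using (a≡a%ℕn+[a/ℕn]*n; n%ℕd<d)
import Data.Integer.Tactic.RingSolver as ℤ-Solver
import Data.Nat.Tactic.RingSolver as ℕ-Solver
open import Data.Fin using (Fin; toℕ; fromℕ<)
open import Data.Fin.Properties using (toℕ<n; fromℕ<-toℕ)
open import Data.Fin.Permutation using (Permutation′)
open import Data.Bool using (Bool; false; _∧_; _∨_)
open import Data.List using (map; allFin; tabulate)
open import Data.List.Properties using (map-tabulate)
open import Data.Nat.ListAction using (sum)
open import Algebra.Properties.Semiring.Sum +-*-semiring
  using (sum-syntax; sum-cong-≗; ∑-distrib-+; *-distribˡ-sum) renaming (sum to ∑)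
open import Data.Product using (_×_; _,_; ∃; proj₁; proj₂)
open import Data.Sum using (_⊎_; inj₁; inj₂)
open import Data.Empty using (⊥-elim)
open import Function using (_∘_; id)
open import Relation.Nullary.Decidable using (Dec; does; yes; no)
open import Relation.Binary.PropositionalEquality

bounded-multiple : ∀ {r a s} (q : ℤ) → a < r → s < r + r → + s ≡ + a ℤ.+ q ℤ.* + r →
                   s ≡ a ⊎ s ≡ a + r
bounded-multiple {zero} q () _ _
bounded-multiple {suc r} {a} (+ 0) _ _ e = inj₁ (trans (+-injective e) (+-identityʳ a))
bounded-multiple {suc r} {a} (+ 1) _ _ e =
  inj₂ (trans (+-injective e) (cong (λ t → a + suc t) (+-identityʳ r)))
bounded-multiple {suc r} {a} {s} (+ suc (suc q)) _ s<2r e =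
  ⊥-elim (<⇒≱ s<2r (subst (suc r + suc r ≤_) (sym (+-injective e)) 2r≤a+qr))
  where
  2r≤a+qr : suc r + suc r ≤ a + (suc r + (suc r + q * suc r))
  2r≤a+qr = ≤-trans (+-monoʳ-≤ (suc r) (m≤m+n (suc r) _)) (m≤n+m _ a)
bounded-multiple {suc r} {a} {s} -[1+ q ] a<r _ e =
  ⊥-elim (<⇒≱ a<r (subst (suc r ≤_) (sym (+-injective a≡s+qr)) r≤s+qr))
  where
  move : ∀ (a q r : ℤ) → a ≡ (a ℤ.+ q ℤ.* r) ℤ.+ (ℤ.- q) ℤ.* r
  move = ℤ-Solver.solve-∀
  a≡s+qr : + a ≡ + s ℤ.+ + suc q ℤ.* + suc r
  a≡s+qr = trans (move (+ a) -[1+ q ] (+ suc r)) (cong (ℤ._+ + suc q ℤ.* + suc r) (sym e))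
  r≤s+qr : suc r ≤ s + (suc r + q * suc r)
  r≤s+qr = ≤-trans (m≤m+n (suc r) _) (m≤n+m _ s)

residue-decomposition : ∀ {x y : ℤ} a b t qa qb qt R →
  x ≡ a ℤ.+ qa ℤ.* R → y ≡ b ℤ.+ qb ℤ.* R → x ℤ.- y ≡ t ℤ.+ qt ℤ.* R →
  b ℤ.+ t ≡ a ℤ.+ (qa ℤ.- qb ℤ.- qt) ℤ.* R
residue-decomposition a b t qa qb qt R refl refl e =
  trans (cong (λ z → b ℤ.+ z) (trans (shift t qt R) (cong (ℤ._- qt ℤ.* R) (sym e))))
        (collect a b qa qb qt R)
  where
  shift : ∀ (t q r : ℤ) → t ≡ (t ℤ.+ q ℤ.* r) ℤ.- q ℤ.* r
  shift = ℤ-Solver.solve-∀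
  collect : ∀ (a b qa qb qt r : ℤ) →
            b ℤ.+ ((a ℤ.+ qa ℤ.* r) ℤ.- (b ℤ.+ qb ℤ.* r) ℤ.- qt ℤ.* r)
              ≡ a ℤ.+ (qa ℤ.- qb ℤ.- qt) ℤ.* r
  collect = ℤ-Solver.solve-∀

module _ (r : ℕ) .{{_ : NonZero r}} where

  %ℕ-+-sub-congruent : ∀ x y → ∃ λ q → + (y %ℕ r + (x ℤ.- y) %ℕ r) ≡ + (x %ℕ r) ℤ.+ q ℤ.* + r
  %ℕ-+-sub-congruent x y = x /ℕ r ℤ.- y /ℕ r ℤ.- (x ℤ.- y) /ℕ r ,
    residue-decomposition (+ (x %ℕ r)) (+ (y %ℕ r)) (+ ((x ℤ.- y) %ℕ r))
                          (x /ℕ r) (y /ℕ r) ((x ℤ.- y) /ℕ r) (+ r)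
    (a≡a%ℕn+[a/ℕn]*n x r) (a≡a%ℕn+[a/ℕn]*n y r) (a≡a%ℕn+[a/ℕn]*n (x ℤ.- y) r)

  %ℕ-+-sub : ∀ x y →
    y %ℕ r + (x ℤ.- y) %ℕ r ≡ x %ℕ r ⊎ y %ℕ r + (x ℤ.- y) %ℕ r ≡ x %ℕ r + r
  %ℕ-+-sub x y = bounded-multiple (proj₁ (%ℕ-+-sub-congruent x y)) (n%ℕd<d x r)
    (+-mono-< (n%ℕd<d y r) (n%ℕd<d (x ℤ.- y) r)) (proj₂ (%ℕ-+-sub-congruent x y))

  %ℕ-+-sub-no-carry : ∀ x y → y %ℕ r ≤ x %ℕ r → y %ℕ r + (x ℤ.- y) %ℕ r ≡ x %ℕ r
  %ℕ-+-sub-no-carry x y y≤x with %ℕ-+-sub x y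
  ... | inj₁ e = e
  ... | inj₂ e = ⊥-elim (<-irrefl e (+-mono-≤-< y≤x (n%ℕd<d (x ℤ.- y) r)))

  %ℕ-+-sub-carry : ∀ x y → x %ℕ r < y %ℕ r → y %ℕ r + (x ℤ.- y) %ℕ r ≡ x %ℕ r + r
  %ℕ-+-sub-carry x y x<y with %ℕ-+-sub x y
  ... | inj₁ e = ⊥-elim (<⇒≱ x<y (subst (y %ℕ r ≤_) e (m≤m+n _ _)))
  ... | inj₂ e = e

telescope-step : ∀ r x x′ k t y y′ a a′ →
  r * x′ + k ≡ r * y′ + a′ → r * x + (a′ + t) ≡ r * y + a → r * (x + x′) + (k + t) ≡ r * (y + y′) + a
telescope-step r x x′ k t y y′ a a′ e′ e = begin
  r * (x + x′) + (k + t)        ≡⟨ regroup r x x′ k t ⟩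
  r * x + ((r * x′ + k) + t)    ≡⟨ cong (λ z → r * x + (z + t)) e′ ⟩
  r * x + ((r * y′ + a′) + t)   ≡⟨ swap r x y′ a′ t ⟩
  r * y′ + (r * x + (a′ + t))   ≡⟨ cong (λ z → r * y′ + z) e ⟩
  r * y′ + (r * y + a)          ≡⟨ ungroup r y y′ a ⟩
  r * (y + y′) + a              ∎
  where
  open ≡-Reasoning
  regroup : ∀ r x x′ k t → r * (x + x′) + (k + t) ≡ r * x + ((r * x′ + k) + t)
  regroup = ℕ-Solver.solve-∀
  swap : ∀ r x y′ a′ t → r * x + ((r * y′ + a′) + t) ≡ r * y′ + (r * x + (a′ + t))
  swap = ℕ-Solver.solve-∀
  ungroup : ∀ r y y′ a → r * y′ + (r * y + a) ≡ r * (y + y′) + a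
  ungroup = ℕ-Solver.solve-∀

sum-map-allFin : ∀ {m} (f : Fin m → ℕ) → sum (map f (allFin m)) ≡ ∑[ i < m ] f i
sum-map-allFin f = trans (cong sum (map-tabulate id f)) (sum-tabulate f)
  where
  sum-tabulate : ∀ {m} (f : Fin m → ℕ) → sum (tabulate f) ≡ ∑[ i < m ] f i
  sum-tabulate {zero} f = refl
  sum-tabulate {suc m} f = cong (λ z → f Fin.zero + z) (sum-tabulate (f ∘ Fin.suc))

∑-+-∑-weighted : ∀ {m} (f : Fin m → ℕ) →
                 ∑[ i < m ] f i + ∑[ i < m ] (f i * suc (toℕ i)) ≡ ∑[ i < m ] (f i * suc (suc (toℕ i)))
∑-+-∑-weighted {m} f = trans (sym (∑-distrib-+ {m} f (λ i → f i * suc (toℕ i))))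
                             (sum-cong-≗ {m} (λ i → sym (*-suc (f i) (suc (toℕ i)))))

module _ (r : ℕ) .{{_ : NonZero r}} {n : ℕ} (σ : Permutation′ n) (c : Fin n → ℤ) where

  private
    χ : Bool → ℕ
    χ = b2n r σ c
    ρ : ℤ → ℕ
    ρ = res r σ c
    colour : ℕ → ℤ
    colour = cc r σ c
    HDes? Des? : ℕ → Bool
    HDes? = isHDes r σ c
    Des? = isDes r σ c
    count : (ℕ → Bool) → ℕ → ℕ → ℕ
    count = countFrom r σ c

  colour-lookup : ∀ j (j<n : j < n) → colour j ≡ c (fromℕ< j<n)
  colour-lookup j j<n with j <? n
  ... | yes _ = refl
  ... | no j≮n = ⊥-elim (j≮n j<n)

  isHDes-last : HDes? (n ∸ 1) ≡ false
  isHDes-last with suc (n ∸ 1) <? n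
  ... | yes n≤n∸1 = ⊥-elim (<⇒≱ n≤n∸1 (m≤n+m∸n n 1))
  ... | no _ = refl

  isDes-last : Des? (n ∸ 1) ≡ false
  isDes-last with suc (n ∸ 1) <? n
  ... | yes n≤n∸1 = ⊥-elim (<⇒≱ n≤n∸1 (m≤n+m∸n n 1))
  ... | no _ = refl

  -- The decisions are abstract so that the clauses of isDes and isHDes can be matched against them.
  carry-identity : ∀ x y (s : Bool) (x<?y : Dec (ρ x < ρ y)) (x≟y : Dec (ρ x ≡ ρ y)) →
    r * χ (does x≟y ∧ s) + (ρ y + ρ (x ℤ.- y)) ≡ r * χ (does x<?y ∨ (does x≟y ∧ s)) + ρ x
  carry-identity x y s (yes x<y) (yes x≡y) = ⊥-elim (<-irrefl x≡y x<y)
  carry-identity x y s (yes x<y) (no _) = begin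
    r * 0 + (ρ y + ρ (x ℤ.- y))  ≡⟨ cong (λ z → r * 0 + z) (%ℕ-+-sub-carry r x y x<y) ⟩
    r * 0 + (ρ x + r)            ≡⟨ cong₂ _+_ (*-zeroʳ r) (+-comm (ρ x) r) ⟩
    r + ρ x                      ≡⟨ cong (_+ ρ x) (sym (*-identityʳ r)) ⟩
    r * 1 + ρ x                  ∎
    where open ≡-Reasoning
  carry-identity x y s (no _) (yes x≡y) =
    cong (λ z → r * χ s + z) (%ℕ-+-sub-no-carry r x y (≤-reflexive (sym x≡y)))
  carry-identity x y s (no x≮y) (no _) =
    cong (λ z → r * 0 + z) (%ℕ-+-sub-no-carry r x y (≮⇒≥ x≮y))

  position-identity : ∀ j → suc j < n →
    r * χ (HDes? j) + (ρ (colour (suc j)) + ρ (colour j ℤ.- colour (suc j)))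
      ≡ r * χ (Des? j) + ρ (colour j)
  position-identity j sj<n with suc j <? n
  ... | no sj≮n = ⊥-elim (sj≮n sj<n)
  ... | yes sj<n′ rewrite colour-lookup j (<-trans (n<1+n j) sj<n′) | colour-lookup (suc j) sj<n′ =
    carry-identity x y _ (ρ x <? ρ y) (ρ x ≟ ρ y)
    where
    x y : ℤ
    x = c (fromℕ< (<-trans (n<1+n j) sj<n′))
    y = c (fromℕ< sj<n′)

  kd-suc : ∀ m →
    kd r σ c (suc m) ≡ kd r σ c m + ρ (colour (n ∸ suc (suc m)) ℤ.- colour (n ∸ suc m))
  kd-suc m = cong₂ (λ i i′ → kd r σ c m + ρ (colour i ℤ.- colour i′))
                   (∸-+-assoc n 2 m) (∸-+-assoc n 1 m)

  suffix-identity-step : ∀ {j j′ L K} → suc j ≡ j′ → j′ < n →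
    r * count HDes? j′ L + K ≡ r * count Des? j′ L + ρ (colour j′) →
    r * count HDes? j (suc L) + (K + ρ (colour j ℤ.- colour j′))
      ≡ r * count Des? j (suc L) + ρ (colour j)
  suffix-identity-step {j} {L = L} {K} refl j′<n ih =
    telescope-step r (χ (HDes? j)) (count HDes? (suc j) L) K (ρ (colour j ℤ.- colour (suc j)))
                     (χ (Des? j)) (count Des? (suc j) L) (ρ (colour j)) (ρ (colour (suc j)))
                     ih (position-identity j j′<n)

  -- Indexed by the distance m to the last position, where kd m is k at position n ∸ suc m.
  suffix-identity : ∀ m → m < n →
    r * count HDes? (n ∸ suc m) (suc m) + kd r σ c m
      ≡ r * count Des? (n ∸ suc m) (suc m) + ρ (colour (n ∸ suc m))
  suffix-identity zero _ rewrite isHDes-last | isDes-last = refl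
  suffix-identity (suc m) sm<n =
    trans (cong (λ z → r * count HDes? (n ∸ suc (suc m)) (suc (suc m)) + z) (kd-suc m))
          (suffix-identity-step {L = suc m} (sym (+-∸-assoc 1 sm<n)) (∸-monoʳ-< z<s (<⇒≤ sm<n))
                                (suffix-identity m (<⇒≤ sm<n)))

  h-k-identity : (i : Fin n) → r * h r σ c i + k r σ c i ≡ r * d r σ c i + ρ (c i)
  h-k-identity i = trans (reindex n∸[1+m]≡t (+-∸-assoc 1 t<n) (∸-+-assoc n 1 t))
                         (cong (λ z → r * d r σ c i + ρ z) colour-toℕ)
    where
    t m : ℕ
    t = toℕ i
    m = n ∸ suc t
    t<n : t < n
    t<n = toℕ<n i
    n∸[1+m]≡t : n ∸ suc m ≡ t
    n∸[1+m]≡t = trans (cong (n ∸_) (sym (+-∸-assoc 1 t<n))) (m∸[m∸n]≡n (<⇒≤ t<n))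
    reindex : ∀ {j L m′} → n ∸ suc m ≡ j → L ≡ suc m → m′ ≡ m →
              r * count HDes? j L + kd r σ c m′ ≡ r * count Des? j L + ρ (colour j)
    reindex refl refl refl = suffix-identity m (∸-monoʳ-< z<s t<n)
    colour-toℕ : colour t ≡ c i
    colour-toℕ = trans (colour-lookup t t<n) (cong c (fromℕ<-toℕ i t<n))

  count-suc : ∀ P j L → count P (suc j) L ≡ count (P ∘ suc) j L
  count-suc P j zero = refl
  count-suc P j (suc L) = cong (λ z → χ (P (suc j)) + z) (count-suc P (suc j) L)

  count-from-zero : ∀ P m → count P 0 m ≡ ∑[ i < m ] χ (P (toℕ i))
  count-from-zero P zero = refl
  count-from-zero P (suc m) =
    cong (λ z → χ (P 0) + z) (trans (count-suc P 0 m) (count-from-zero (P ∘ suc) m))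

  ∑-suffix-counts : ∀ P m →
    ∑[ i < m ] (count P (toℕ i) (m ∸ toℕ i)) ≡ ∑[ i < m ] (χ (P (toℕ i)) * suc (toℕ i))
  ∑-suffix-counts P zero = refl
  ∑-suffix-counts P (suc m) = begin
    count P 0 (suc m) + ∑[ i < m ] (count P (suc (toℕ i)) (m ∸ toℕ i))
      ≡⟨ cong₂ _+_ (count-from-zero P (suc m))
                   (sum-cong-≗ {m} (λ i → count-suc P (toℕ i) (m ∸ toℕ i))) ⟩
    (χ (P 0) + ∑[ i < m ] f i) + ∑[ i < m ] (count (P ∘ suc) (toℕ i) (m ∸ toℕ i))
      ≡⟨ cong (λ z → χ (P 0) + ∑[ i < m ] f i + z) (∑-suffix-counts (P ∘ suc) m) ⟩
    (χ (P 0) + ∑[ i < m ] f i) + ∑[ i < m ] (f i * suc (toℕ i))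
      ≡⟨ +-assoc (χ (P 0)) _ _ ⟩
    χ (P 0) + (∑[ i < m ] f i + ∑[ i < m ] (f i * suc (toℕ i)))
      ≡⟨ cong₂ _+_ (sym (*-identityʳ (χ (P 0)))) (∑-+-∑-weighted f) ⟩
    χ (P 0) * 1 + ∑[ i < m ] (f i * suc (suc (toℕ i)))
      ∎
    where
    open ≡-Reasoning
    f : Fin m → ℕ
    f i = χ (P (suc (toℕ i)))

lemma5p1 : (r n : ℕ) .{{_ : NonZero r}} → 1 ≤ n →
    (σ : Permutation′ n) (c : Fin n → ℤ) →
    ((i : Fin n) → r * h r σ c i + k r σ c i ≡ r * d r σ c i + res r σ c (c i))
    × (sum (map (λ i → r * h r σ c i + k r σ c i) (allFin n)) ≡ fmaj r σ c)
lemma5p1 r n _ σ c = h-k-identity r σ c , (begin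
  sum (map (λ i → r * h r σ c i + k r σ c i) (allFin n))
    ≡⟨ sum-map-allFin (λ i → r * h r σ c i + k r σ c i) ⟩
  ∑[ i < n ] (r * h r σ c i + k r σ c i)
    ≡⟨ sum-cong-≗ {n} (h-k-identity r σ c) ⟩
  ∑[ i < n ] (r * d r σ c i + res r σ c (c i))
    ≡⟨ ∑-distrib-+ {n} (λ i → r * d r σ c i) (λ i → res r σ c (c i)) ⟩
  ∑[ i < n ] (r * d r σ c i) + ∑[ i < n ] res r σ c (c i)
    ≡⟨ cong₂ _+_ (sym (*-distribˡ-sum r (d r σ c))) (sym (sum-map-allFin (λ i → res r σ c (c i)))) ⟩
  r * ∑[ i < n ] d r σ c i + sum (map (λ i → res r σ c (c i)) (allFin n))
    ≡⟨ cong (λ s → r * s + sum (map (λ i → res r σ c (c i)) (allFin n))) ∑d≡sumDes ⟩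
  fmaj r σ c
    ∎)
  where
  open ≡-Reasoning
  ∑d≡sumDes : ∑[ i < n ] d r σ c i ≡ sumDes r σ c
  ∑d≡sumDes = trans (∑-suffix-counts r σ c (isDes r σ c) n)
                    (sym (sum-map-allFin {n} (λ i → b2n r σ c (isDes r σ c (toℕ i)) * suc (toℕ i))))
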